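{- Let $\ell$ be a $d$-labeling of ${\overset{\leftrightarrow}{K}}_n$, let $k\ge 2$, let $w$ be a vertex, let $w'\ne w$ be another vertex, and suppose there are (simple) directed paths $P_1,P_2$ from $w$ to $w'$ (not necessarily internally disjoint, possibly single edges), distinct values $i_1,i_2\in\mathrm{im}(w)$ and a value $j\in[d]$ such that $P_1$ maps $i_1$ to $j$ and $P_2$ maps $i_2$ to $j$. Define $f:[d]\to[d]$ by $f(i_2)=j$; for $x\in\mathrm{im}(w)\setminus\{i_2\}$, $f(x)$ is the value to which $P_1$ maps $x$; and for $x\in[d]\setminus\mathrm{im}(w)$, $f(x)$ is arbitrary. Delete all vertices of $P_1\cup P_2$ and add a new vertex $w^\star$ joined by edges in both directions to all remaining vertices, obtaining ${\overset{\leftrightarrow}{K}}_{n'}$ with labeling $\ell'$ given by: for each remaining vertex $v$, $\ell'_{vw^\star}(x)=f(\ell_{vw}(x))$; for each remaining vertex $u$, $\ell'_{w^\star u}=\ell_{w'u}$; all edges not involving $w^\star$ keep their labels. Then: (i) if $w$ is $k$-compressed in $({\overset{\leftrightarrow}{K}}_n,\ell)$, then $w^\star$ is $(k-1)$-compressed in $({\overset{\leftrightarrow}{K}}_{n'},\ell')$; (ii) if $({\overset{\leftrightarrow}{K}}_{n'},\ell')$ has a fixed-point cycle, then $({\overset{\leftrightarrow}{K}}_n,\ell)$ has a fixed-point cycle.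
   Context: ${\overset{\leftrightarrow}{K}}_n$ is the complete bidirected graph on $n$ vertices (both directed edges $(u,v)$ and $(v,u)$ for each pair of distinct vertices). A $d$-labeling assigns to each directed edge $e$ a function $\ell_e:[d]\to[d]$, $[d]=\{1,\dots,d\}$; $\ell_{uv}$ is the label of edge $u\to v$. A path $u_1\to\cdots\to u_m$ maps $x$ to $y$ if $\ell_{u_{m-1}u_m}(\cdots\ell_{u_1u_2}(x)\cdots)=y$. Paths and cycles are simple and directed. A cycle with edges $e_1,\dots,e_k$ in order is a fixed-point cycle if $x\mapsto \ell_{e_k}(\cdots\ell_{e_1}(x)\cdots)$ has a fixed point. The imageset of a vertex $v$ is $\mathrm{im}(v)=\{y\in[d]: \ell_{uv}(x)=y \text{ for some vertex } u\ne v \text{ and some } x\in[d]\}$. A vertex $v$ is $k$-compressed if $|\mathrm{im}(v)|\le k$. -}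

module Defs where

open import Data.Nat using (ℕ; zero; suc; _≤_; _∸_)
open import Data.Bool using (Bool; true; false; not; T)
open import Data.Fin using (Fin; zero; suc)
open import Data.Fin.Properties using (any?) renaming (_≟_ to _≟ᶠ_)
open import Data.Fin.Subset using (Subset; ∣_∣; _∈_)
open import Data.Vec using (tabulate)
open import Data.List using (List; []; _∷_; _++_; length)
open import Data.List.Relation.Unary.All using (All)
open import Data.List.Relation.Unary.Unique.Propositional using (Unique)
open import Data.Product using (Σ; ∃; _×_; _,_)
open import Data.Sum using (_⊎_)
open import Relation.Nullary using (¬_)
open import Relation.Nullary.Decidable using (⌊_⌋; _×-dec_; ¬?; _⊎-dec_)
open import Relation.Binary.PropositionalEquality using (_≡_; _≢_)
import Data.List.Membership.Propositional as MemP
import Data.List.Membership.DecPropositional as MemD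

-- A d-labeling of the complete bidirected graph on the vertex set Fin N:
-- ℓ u v is the label of the edge u → v (values for u ≡ v are irrelevant).
Labeling : ℕ → ℕ → Set
Labeling N d = Fin N → Fin N → Fin d → Fin d

-- A "present" predicate selects the vertex set of an induced complete
-- bidirected subgraph of the complete bidirected graph on Fin N.
Present : ℕ → Set
Present N = Fin N → Bool

allPresent : {N : ℕ} → Present N
allPresent _ = true

pathMap : {N d : ℕ} → Labeling N d → Fin N → List (Fin N) → Fin d → Fin d
pathMap ℓ u []       x = x
pathMap ℓ u (v ∷ vs) x = pathMap ℓ v vs (ℓ u v x)

lastV : {A : Set} → A → List A → A
lastV a []       = a
lastV a (b ∷ bs) = lastV b bs

-- A simple directed path w → v₁ → ... → vₘ = w' in the complete bidirected
-- graph on Fin n, given by the list [v₁,...,vₘ] of vertices after w.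
IsPath : {n : ℕ} → Fin n → Fin n → List (Fin n) → Set
IsPath w w' P = Unique (w ∷ P) × lastV w P ≡ w'

im : {N d : ℕ} → Present N → Labeling N d → Fin N → Subset d
im present ℓ v = tabulate λ y →
  ⌊ any? (λ u → (T? (present u)) ×-dec (¬? (u ≟ᶠ v)) ×-dec any? (λ x → ℓ u v x ≟ᶠ y)) ⌋
  where
  open import Relation.Nullary.Decidable using () renaming (T? to T?)

Compressed : {N d : ℕ} → Present N → Labeling N d → Fin N → ℕ → Set
Compressed present ℓ v k = ∣ im present ℓ v ∣ ≤ k

-- A fixed-point cycle: a simple directed cycle v → v₁ → ... → vₘ → v with
-- m ≥ 1 (so at least 2 vertices), all vertices present and distinct, whose
-- composed label map has a fixed point.
HasFixedPointCycle : {N d : ℕ} → Present N → Labeling N d → Set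
HasFixedPointCycle {N} {d} present ℓ =
  Σ (Fin N) λ v → Σ (List (Fin N)) λ vs →
    1 ≤ length vs × Unique (v ∷ vs) × All (λ u → T (present u)) (v ∷ vs) ×
    ∃ λ (x : Fin d) → pathMap ℓ v (vs ++ v ∷ []) x ≡ x

-- Vertex set ⊆ Fin (suc n): zero is the new vertex w⋆,
-- suc v stands for the old vertex v, present iff v lies on neither path
-- (the paths P₁, P₂ have vertex sets w ∷ P₁, w ∷ P₂).
contractPresent : {n : ℕ} → Fin n → List (Fin n) → List (Fin n) → Present (suc n)
contractPresent w P₁ P₂ zero    = true
contractPresent w P₁ P₂ (suc v) =
  not ⌊ (v ∈? (w ∷ P₁)) ⊎-dec (v ∈? (w ∷ P₂)) ⌋
  where open MemD _≟ᶠ_ using (_∈?_)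

contractLabel : {n d : ℕ} → Labeling n d → Fin n → Fin n → (Fin d → Fin d) →
                Labeling (suc n) d
contractLabel ℓ w w' f zero    zero    x = x
contractLabel ℓ w w' f (suc v) zero    x = f (ℓ v w x)
contractLabel ℓ w w' f zero    (suc u) x = ℓ w' u x
contractLabel ℓ w w' f (suc u) (suc v) x = ℓ u v x

-- (i) Every value entering w⋆ is f applied to a value entering w, and f identifies
-- the two image values i₁ ≠ i₂ (both are sent to j), so im(w⋆) ⊆ f[im(w) ∖ {i₁}].
-- (ii) A fixed-point cycle avoiding w⋆ is one of the original graph. Otherwise rotate
-- it to start at w⋆: it is w⋆ → M → w⋆, and its map is x ↦ f z where z is the image
-- of x along w' → M → w. If z = i₂, the cycle w → P₂ → w' → M → w fixes z; otherwise
-- z ∈ im(w) and f z is the image of z along P₁, so w → P₁ → w' → M → w fixes z.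
module Submission where

open import Defs
open import Data.Nat using (ℕ; suc; _≤_; _<_; _∸_; z≤n; s≤s)
open import Data.Nat.Properties using (≤-reflexive; ≤-trans; <-≤-trans; n≤1+n; ∸-monoˡ-≤)
open import Data.Bool using (Bool; true; false; T)
open import Data.Bool.Properties using (T-≡)
open import Data.Unit using (tt)
open import Data.Empty using (⊥-elim)
open import Data.Fin using (Fin; zero; suc) renaming (_≟_ to _≟ᶠ_)
open import Data.Fin.Subset using (Subset; ∣_∣; _∈_; _-_; ⁅_⁆) renaming (⊥ to ∅)
open import Data.Fin.Subset.Properties
  using (p─⊥≡p; p─q⊆p; p⊆q⇒∣p∣≤∣q∣; ∣⊥∣≡0; x∈p∧x≢y⇒x∈p-y; x∈p⇒∣p-x∣<∣p∣)
open import Data.Vec using ([]; _∷_; tabulate; here; there)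
open import Data.Vec.Properties using (lookup∘tabulate; []=⇒lookup; lookup⇒[]=)
open import Data.List using (List; []; _∷_; _++_; [_]; length; map)
open import Data.List.Properties using (++-assoc; map-++; length-map; length-++-≤ʳ)
open import Data.List.Relation.Unary.All as All using (All; _∷_)
import Data.List.Relation.Unary.All.Properties as All
open import Data.List.Relation.Unary.All.Properties using (All¬⇒¬Any)
open import Data.List.Relation.Unary.Any using (here; there)
open import Data.List.Relation.Unary.Unique.Propositional using (Unique; _∷_)
import Data.List.Relation.Unary.Unique.Propositional.Properties as Unique
open import Data.List.Relation.Binary.Permutation.Propositional using (_↭_; ↭⇒↭ₛ)
open import Data.List.Relation.Binary.Permutation.Propositional.Properties
  using (All-resp-↭; ++-comm)
open import Data.List.Relation.Binary.Permutation.Setoid.Properties using (Unique-resp-↭)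
open import Data.List.Membership.Propositional using () renaming (_∈_ to _∈ₗ_)
open import Data.List.Membership.Propositional.Properties using (∈-∃++)
import Data.List.Membership.DecPropositional as DecMembership
open import Data.Product using (Σ; ∃; _×_; _,_; proj₁; proj₂)
open import Data.Sum using (inj₁; inj₂)
open import Function using (_∘_; Equivalence)
open import Relation.Nullary using (¬_; Dec; yes; no)
open import Relation.Nullary.Decidable
  using (⌊_⌋; T?; toWitness; fromWitness; toWitnessFalse; _×-dec_; ¬?; _⊎-dec_)
open import Data.Fin.Properties using (any?)
open import Relation.Binary.PropositionalEquality
  using (_≡_; _≢_; refl; sym; trans; cong; cong₂; subst; setoid; module ≡-Reasoning)

_∈?_ : ∀ {n} (v : Fin n) xs → Dec (v ∈ₗ xs)
_∈?_ {n} = DecMembership._∈?_ (_≟ᶠ_ {n})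

∈-tabulate⁻ : ∀ {d} (g : Fin d → Bool) {x} → x ∈ tabulate g → T (g x)
∈-tabulate⁻ g {x} x∈ = subst T (trans (sym ([]=⇒lookup x∈)) (lookup∘tabulate g x)) tt

∈-tabulate⁺ : ∀ {d} (g : Fin d → Bool) {x} → T (g x) → x ∈ tabulate g
∈-tabulate⁺ g {x} gx = lookup⇒[]= x (tabulate g) (trans (lookup∘tabulate g x) (Equivalence.to T-≡ gx))

∣p∣≤1+∣p-x∣ : ∀ {d} (p : Subset d) x → ∣ p ∣ ≤ suc ∣ p - x ∣
∣p∣≤1+∣p-x∣ (true  ∷ p) zero    = ≤-reflexive (cong (suc ∘ ∣_∣) (sym (p─⊥≡p p)))
∣p∣≤1+∣p-x∣ (false ∷ p) zero    = ≤-trans (n≤1+n _) (≤-reflexive (cong (suc ∘ ∣_∣) (sym (p─⊥≡p p))))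
∣p∣≤1+∣p-x∣ (true  ∷ p) (suc x) = s≤s (∣p∣≤1+∣p-x∣ p x)
∣p∣≤1+∣p-x∣ (false ∷ p) (suc x) = ∣p∣≤1+∣p-x∣ p x

x∈p-y⇒x≢y : ∀ {d} (p : Subset d) y {x} → x ∈ p - y → x ≢ y
x∈p-y⇒x≢y (_ ∷ p) zero    (there _)  ()
x∈p-y⇒x≢y (_ ∷ p) (suc y) here       ()
x∈p-y⇒x≢y (_ ∷ p) (suc y) (there x∈) refl = x∈p-y⇒x≢y p y x∈ refl

infix 4 _⊆_[_]

_⊆_[_] : ∀ {e d} → Subset d → (Fin e → Fin d) → Subset e → Set
p ⊆ f [ q ] = ∀ {y} → y ∈ p → ∃ λ x → x ∈ q × f x ≡ y

⊆-image⇒∣p∣≤∣q∣ : ∀ {e d} (f : Fin e → Fin d) (p : Subset d) (q : Subset e) →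
  p ⊆ f [ q ] → ∣ p ∣ ≤ ∣ q ∣
⊆-image⇒∣p∣≤∣q∣ {d = d} f p [] p⊆ =
  ≤-trans (p⊆q⇒∣p∣≤∣q∣ p⊆∅) (≤-reflexive (∣⊥∣≡0 d))
  where
  p⊆∅ : ∀ {y} → y ∈ p → y ∈ ∅
  p⊆∅ y∈ with p⊆ y∈
  ... | () , _
⊆-image⇒∣p∣≤∣q∣ f p (false ∷ q) p⊆ = ⊆-image⇒∣p∣≤∣q∣ (f ∘ suc) p q p⊆′
  where
  p⊆′ : p ⊆ f ∘ suc [ q ]
  p⊆′ y∈ with p⊆ y∈
  ... | suc x , there x∈ , fx≡y = x , x∈ , fx≡y
⊆-image⇒∣p∣≤∣q∣ f p (true ∷ q) p⊆ =
  ≤-trans (∣p∣≤1+∣p-x∣ p (f zero)) (s≤s (⊆-image⇒∣p∣≤∣q∣ (f ∘ suc) (p - f zero) q p⊆′))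
  where
  p⊆′ : p - f zero ⊆ f ∘ suc [ q ]
  p⊆′ y∈ with p⊆ (p─q⊆p p ⁅ f zero ⁆ y∈)
  ... | zero  , _        , f0≡y  = ⊥-elim (x∈p-y⇒x≢y p (f zero) y∈ (sym f0≡y))
  ... | suc x , there x∈ , fx≡y = x , x∈ , fx≡y

Enters : ∀ {N d} → Present N → Labeling N d → Fin N → Fin d → Set
Enters {N} {d} present ℓ v y =
  Σ (Fin N) λ u → T (present u) × u ≢ v × ∃ λ (x : Fin d) → ℓ u v x ≡ y

enters? : ∀ {N d} (present : Present N) (ℓ : Labeling N d) v y → Dec (Enters present ℓ v y)
enters? present ℓ v y =
  any? (λ u → T? (present u) ×-dec ¬? (u ≟ᶠ v) ×-dec any? (λ x → ℓ u v x ≟ᶠ y))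

∈-im⁻ : ∀ {N d} (present : Present N) (ℓ : Labeling N d) v {y} →
  y ∈ im present ℓ v → Enters present ℓ v y
∈-im⁻ present ℓ v {y} y∈ = toWitness (∈-tabulate⁻ (⌊_⌋ ∘ enters? present ℓ v) y∈)

∈-im⁺ : ∀ {N d} (present : Present N) (ℓ : Labeling N d) v {y} →
  Enters present ℓ v y → y ∈ im present ℓ v
∈-im⁺ present ℓ v {y} e = ∈-tabulate⁺ (⌊_⌋ ∘ enters? present ℓ v) (fromWitness e)

pathMap-++ : ∀ {N d} (ℓ : Labeling N d) u xs ys x →
  pathMap ℓ u (xs ++ ys) x ≡ pathMap ℓ (lastV u xs) ys (pathMap ℓ u xs x)
pathMap-++ ℓ u []       ys x = refl
pathMap-++ ℓ u (v ∷ xs) ys x = pathMap-++ ℓ v xs ys (ℓ u v x)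

lastV-++-[_] : ∀ {A : Set} (a : A) xs b → lastV a (xs ++ [ b ]) ≡ b
lastV-++-[ a ] []       b = refl
lastV-++-[ a ] (x ∷ xs) b = lastV-++-[ x ] xs b

lastV∈ : ∀ {A : Set} (a : A) xs → lastV a xs ∈ₗ a ∷ xs
lastV∈ a []       = here refl
lastV∈ a (x ∷ xs) = there (lastV∈ x xs)

cycleMap : ∀ {N d} → Labeling N d → Fin N → List (Fin N) → Fin d → Fin d
cycleMap ℓ v vs = pathMap ℓ v (vs ++ [ v ])

IsFixedPointCycle : ∀ {N d} → Present N → Labeling N d → Fin N → List (Fin N) → Set
IsFixedPointCycle {d = d} present ℓ v vs =
  1 ≤ length vs × Unique (v ∷ vs) × All (λ u → T (present u)) (v ∷ vs) ×
  ∃ λ (x : Fin d) → cycleMap ℓ v vs x ≡ x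

cycleMap-split : ∀ {N d} (ℓ : Labeling N d) v as a bs x →
  cycleMap ℓ v (as ++ a ∷ bs) x ≡ pathMap ℓ a (bs ++ [ v ]) (pathMap ℓ v (as ++ [ a ]) x)
cycleMap-split ℓ v as a bs x = begin
  pathMap ℓ v ((as ++ a ∷ bs) ++ [ v ]) x
    ≡⟨ cong (λ vs → pathMap ℓ v vs x) (++-assoc as (a ∷ bs) [ v ]) ⟩
  pathMap ℓ v (as ++ a ∷ bs ++ [ v ]) x
    ≡⟨ cong (λ vs → pathMap ℓ v vs x) (sym (++-assoc as [ a ] (bs ++ [ v ]))) ⟩
  pathMap ℓ v ((as ++ [ a ]) ++ bs ++ [ v ]) x
    ≡⟨ pathMap-++ ℓ v (as ++ [ a ]) (bs ++ [ v ]) x ⟩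
  pathMap ℓ (lastV v (as ++ [ a ])) (bs ++ [ v ]) (pathMap ℓ v (as ++ [ a ]) x)
    ≡⟨ cong (λ u → pathMap ℓ u (bs ++ [ v ]) (pathMap ℓ v (as ++ [ a ]) x)) (lastV-++-[ v ] as a) ⟩
  pathMap ℓ a (bs ++ [ v ]) (pathMap ℓ v (as ++ [ a ]) x) ∎
  where open ≡-Reasoning

rotate : ∀ {N d} {present : Present N} {ℓ : Labeling N d} v as a bs →
  IsFixedPointCycle present ℓ v (as ++ a ∷ bs) → IsFixedPointCycle present ℓ a (bs ++ v ∷ as)
rotate {ℓ = ℓ} v as a bs (_ , unique , present , x , fixed) =
  nonempty bs , Unique-resp-↭ (setoid _) (↭⇒↭ₛ swap) unique ,
  All-resp-↭ swap present , g x , g-fixed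
  where
  g = pathMap ℓ v (as ++ [ a ])
  h = pathMap ℓ a (bs ++ [ v ])
  swap : v ∷ as ++ a ∷ bs ↭ a ∷ bs ++ v ∷ as
  swap = ++-comm (v ∷ as) (a ∷ bs)
  nonempty : ∀ cs → 1 ≤ length (cs ++ v ∷ as)
  nonempty []      = s≤s z≤n
  nonempty (_ ∷ _) = s≤s z≤n
  g-fixed : cycleMap ℓ a (bs ++ v ∷ as) (g x) ≡ g x
  g-fixed = begin
    cycleMap ℓ a (bs ++ v ∷ as) (g x)  ≡⟨ cycleMap-split ℓ a bs v as (g x) ⟩
    g (h (g x))                        ≡⟨ cong g (sym (cycleMap-split ℓ v as a bs x)) ⟩
    g (cycleMap ℓ v (as ++ a ∷ bs) x)  ≡⟨ cong g fixed ⟩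
    g x                                ∎
    where open ≡-Reasoning

path-return⇒cycle : ∀ {n d} (ℓ : Labeling n d) {w w'} (P M : List (Fin n)) →
  IsPath w w' P → (∀ {u} → u ∈ₗ M → ¬ u ∈ₗ w ∷ P) → Unique M → 1 ≤ length M →
  ∀ {x z} → pathMap ℓ w P z ≡ x → pathMap ℓ w' (M ++ [ w ]) x ≡ z →
  HasFixedPointCycle allPresent ℓ
path-return⇒cycle ℓ {w} {w'} P M (uniqueP , P-ends) disjoint uniqueM nonempty {x} {z} go return =
  w , P ++ M , ≤-trans nonempty (length-++-≤ʳ M {P}) ,
  Unique.++⁺ uniqueP uniqueM (λ (u∈P , u∈M) → disjoint u∈M u∈P) ,
  All.tabulate (λ _ → tt) , z , fixed
  where
  open ≡-Reasoning
  fixed : pathMap ℓ w ((P ++ M) ++ [ w ]) z ≡ z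
  fixed = begin
    pathMap ℓ w ((P ++ M) ++ [ w ]) z
      ≡⟨ cong (λ vs → pathMap ℓ w vs z) (++-assoc P M [ w ]) ⟩
    pathMap ℓ w (P ++ M ++ [ w ]) z
      ≡⟨ pathMap-++ ℓ w P (M ++ [ w ]) z ⟩
    pathMap ℓ (lastV w P) (M ++ [ w ]) (pathMap ℓ w P z)
      ≡⟨ cong₂ (λ u y → pathMap ℓ u (M ++ [ w ]) y) P-ends go ⟩
    pathMap ℓ w' (M ++ [ w ]) x
      ≡⟨ return ⟩
    z ∎

zero∉⇒map-suc : ∀ {n} (xs : List (Fin (suc n))) → ¬ zero ∈ₗ xs → ∃ λ ys → xs ≡ map suc ys
zero∉⇒map-suc []           _     = [] , refl
zero∉⇒map-suc (zero  ∷ xs) zero∉ = ⊥-elim (zero∉ (here refl))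
zero∉⇒map-suc (suc x ∷ xs) zero∉ with zero∉⇒map-suc xs (zero∉ ∘ there)
... | ys , refl = x ∷ ys , refl

module Contraction {n d : ℕ} (ℓ : Labeling n d) (w w' : Fin n) (P₁ P₂ : List (Fin n))
                   (f : Fin d → Fin d) where

  present′ : Present (suc n)
  present′ = contractPresent w P₁ P₂

  ℓ′ : Labeling (suc n) d
  ℓ′ = contractLabel ℓ w w' f

  I : Subset d
  I = im allPresent ℓ w

  off-paths : ∀ v → T (present′ (suc v)) → ¬ v ∈ₗ w ∷ P₁ × ¬ v ∈ₗ w ∷ P₂
  off-paths v present = (off ∘ inj₁) , (off ∘ inj₂)
    where off = toWitnessFalse {a? = (v ∈? (w ∷ P₁)) ⊎-dec (v ∈? (w ∷ P₂))} present

  All-off-paths : ∀ {M} → All (T ∘ present′ ∘ suc) M → ∀ {v} → v ∈ₗ M →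
    ¬ v ∈ₗ w ∷ P₁ × ¬ v ∈ₗ w ∷ P₂
  All-off-paths present v∈M = off-paths _ (All.lookup present v∈M)

  present⇒≢w : ∀ v → T (present′ (suc v)) → v ≢ w
  present⇒≢w v present refl = proj₁ (off-paths v present) (here refl)

  im⋆⊆f[I] : im present′ ℓ′ zero ⊆ f [ I ]
  im⋆⊆f[I] y∈ with ∈-im⁻ present′ ℓ′ zero y∈
  ... | zero  , _       , 0≢0 , _     = ⊥-elim (0≢0 refl)
  ... | suc v , present , _   , x , e =
    ℓ v w x , ∈-im⁺ allPresent ℓ w (v , tt , present⇒≢w v present , x , refl) , e

  ∣im⋆∣<∣I∣ : ∀ {i₁ i₂} → i₁ ∈ I → i₂ ∈ I → i₁ ≢ i₂ → f i₁ ≡ f i₂ →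
    ∣ im present′ ℓ′ zero ∣ < ∣ I ∣
  ∣im⋆∣<∣I∣ {i₁} {i₂} i₁∈ i₂∈ i₁≢i₂ f-identifies =
    <-≤-trans (s≤s (⊆-image⇒∣p∣≤∣q∣ f _ (I - i₁) im⋆⊆f[I-i₁])) (x∈p⇒∣p-x∣<∣p∣ i₁∈)
    where
    im⋆⊆f[I-i₁] : im present′ ℓ′ zero ⊆ f [ I - i₁ ]
    im⋆⊆f[I-i₁] y∈ with im⋆⊆f[I] y∈
    ... | x , x∈ , fx≡y with x ≟ᶠ i₁
    ...   | yes refl = i₂ , x∈p∧x≢y⇒x∈p-y i₂∈ (i₁≢i₂ ∘ sym) , trans (sym f-identifies) fx≡y
    ...   | no  x≢i₁ = x , x∈p∧x≢y⇒x∈p-y x∈ x≢i₁ , fx≡y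

  pathMap-lift : ∀ a xs y → pathMap ℓ′ (suc a) (map suc xs) y ≡ pathMap ℓ a xs y
  pathMap-lift a []       y = refl
  pathMap-lift a (x ∷ xs) y = pathMap-lift x xs (ℓ a x y)

  pathMap-into-⋆ : ∀ a xs y →
    pathMap ℓ′ (suc a) (map suc xs ++ [ zero ]) y ≡ f (pathMap ℓ a (xs ++ [ w ]) y)
  pathMap-into-⋆ a []       y = refl
  pathMap-into-⋆ a (x ∷ xs) y = pathMap-into-⋆ x xs (ℓ a x y)

  avoiding-⋆⇒cycle : ∀ {v vs} → ¬ zero ∈ₗ v ∷ vs → IsFixedPointCycle present′ ℓ′ v vs →
    HasFixedPointCycle allPresent ℓ
  avoiding-⋆⇒cycle {v} {vs} zero∉ (nonempty , unique , _ , x , fixed)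
    with zero∉⇒map-suc (v ∷ vs) zero∉
  ... | u ∷ us , refl =
    u , us , subst (1 ≤_) (length-map suc us) nonempty , Unique.map⁻ unique ,
    All.tabulate (λ _ → tt) , x ,
    trans (sym (pathMap-lift u (us ++ [ u ]) x))
          (trans (cong (λ vs → pathMap ℓ′ (suc u) vs x) (map-++ suc us [ u ])) fixed)

  through-⋆⇒at-⋆ : ∀ {v vs} → zero ∈ₗ v ∷ vs → IsFixedPointCycle present′ ℓ′ v vs →
    ∃ λ us → IsFixedPointCycle present′ ℓ′ zero us
  through-⋆⇒at-⋆ {vs = vs} (here refl) cycle = vs , cycle
  through-⋆⇒at-⋆ {v} (there zero∈vs) cycle with ∈-∃++ zero∈vs
  ... | as , bs , refl = bs ++ v ∷ as , rotate v as zero bs cycle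

  return-value∈I : ∀ u M → All (T ∘ present′ ∘ suc) (u ∷ M) → ∀ x →
    pathMap ℓ w' ((u ∷ M) ++ [ w ]) x ∈ I
  return-value∈I u M present x =
    ∈-im⁺ allPresent ℓ w
      (last , tt , present⇒≢w last (All.lookup present (lastV∈ u M)) ,
       pathMap ℓ w' (u ∷ M) x , sym (pathMap-++ ℓ w' (u ∷ M) [ w ] x))
    where last = lastV u M

  module _ {i₂ j : Fin d} (isPath₁ : IsPath w w' P₁) (isPath₂ : IsPath w w' P₂)
           (P₂i₂≡j : pathMap ℓ w P₂ i₂ ≡ j) (fi₂≡j : f i₂ ≡ j)
           (f≗P₁ : ∀ x → x ∈ I → x ≢ i₂ → f x ≡ pathMap ℓ w P₁ x) where

    return⇒cycle : ∀ u M → Unique (u ∷ M) → All (T ∘ present′ ∘ suc) (u ∷ M) →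
      ∀ {x} → f (pathMap ℓ w' ((u ∷ M) ++ [ w ]) x) ≡ x → HasFixedPointCycle allPresent ℓ
    return⇒cycle u M unique present {x} fz≡x with pathMap ℓ w' ((u ∷ M) ++ [ w ]) x ≟ᶠ i₂
    ... | yes z≡i₂ =
      path-return⇒cycle ℓ P₂ (u ∷ M) isPath₂ (proj₂ ∘ All-off-paths present) unique (s≤s z≤n)
        P₂z≡x refl
      where
      z = pathMap ℓ w' ((u ∷ M) ++ [ w ]) x
      open ≡-Reasoning
      P₂z≡x : pathMap ℓ w P₂ z ≡ x
      P₂z≡x = begin
        pathMap ℓ w P₂ z   ≡⟨ cong (pathMap ℓ w P₂) z≡i₂ ⟩
        pathMap ℓ w P₂ i₂  ≡⟨ P₂i₂≡j ⟩
        j                  ≡⟨ sym fi₂≡j ⟩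
        f i₂               ≡⟨ cong f (sym z≡i₂) ⟩
        f z                ≡⟨ fz≡x ⟩
        x                  ∎
    ... | no z≢i₂ =
      path-return⇒cycle ℓ P₁ (u ∷ M) isPath₁ (proj₁ ∘ All-off-paths present) unique (s≤s z≤n)
        (trans (sym (f≗P₁ _ (return-value∈I u M present x) z≢i₂)) fz≡x) refl

    at-⋆⇒cycle : ∀ {us} → IsFixedPointCycle present′ ℓ′ zero us → HasFixedPointCycle allPresent ℓ
    at-⋆⇒cycle {us} (_ , zero∉ ∷ unique , _ ∷ present , x , fixed)
      with zero∉⇒map-suc us (All¬⇒¬Any zero∉)
    ... | u ∷ M , refl =
      return⇒cycle u M (Unique.map⁻ unique) (All.map⁻ present)
        (trans (sym (pathMap-into-⋆ u M (ℓ w' u x))) fixed)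

    cycle′⇒cycle : HasFixedPointCycle present′ ℓ′ → HasFixedPointCycle allPresent ℓ
    cycle′⇒cycle (v , vs , cycle) with zero ∈? (v ∷ vs)
    ... | yes zero∈ = at-⋆⇒cycle (proj₂ (through-⋆⇒at-⋆ zero∈ cycle))
    ... | no  zero∉ = avoiding-⋆⇒cycle zero∉ cycle

lemma7 : (n d : ℕ) (ℓ : Labeling n d) (k : ℕ) → 2 ≤ k →
    (w w' : Fin n) → w ≢ w' →
    (P₁ P₂ : List (Fin n)) → IsPath w w' P₁ → IsPath w w' P₂ →
    (i₁ i₂ j : Fin d) →
    i₁ ∈ im allPresent ℓ w → i₂ ∈ im allPresent ℓ w → i₁ ≢ i₂ →
    pathMap ℓ w P₁ i₁ ≡ j → pathMap ℓ w P₂ i₂ ≡ j →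
    (f : Fin d → Fin d) → f i₂ ≡ j →
    ((x : Fin d) → x ∈ im allPresent ℓ w → x ≢ i₂ → f x ≡ pathMap ℓ w P₁ x) →
    (Compressed allPresent ℓ w k →
       Compressed (contractPresent w P₁ P₂) (contractLabel ℓ w w' f) zero (k ∸ 1))
    × (HasFixedPointCycle (contractPresent w P₁ P₂) (contractLabel ℓ w w' f) →
       HasFixedPointCycle allPresent ℓ)
lemma7 n d ℓ k _ w w' _ P₁ P₂ isPath₁ isPath₂ i₁ i₂ j i₁∈ i₂∈ i₁≢i₂ P₁i₁≡j P₂i₂≡j f fi₂≡j f≗P₁ =
  (λ compressed → ∸-monoˡ-≤ 1 (≤-trans (∣im⋆∣<∣I∣ i₁∈ i₂∈ i₁≢i₂ fi₁≡fi₂) compressed)) ,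
  cycle′⇒cycle isPath₁ isPath₂ P₂i₂≡j fi₂≡j f≗P₁
  where
  open Contraction ℓ w w' P₁ P₂ f
  fi₁≡fi₂ : f i₁ ≡ f i₂
  fi₁≡fi₂ = trans (f≗P₁ i₁ i₁∈ i₁≢i₂) (trans P₁i₁≡j (sym fi₂≡j))
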